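{- The multiplication $\times$ of groves is distributive on the left with respect to the Left sum, the Right sum and the sum: for all groves $x,x',y$, $$(x\dashv x')\times y=(x\times y)\dashv(x'\times y),\quad (x\vdash x')\times y=(x\times y)\vdash(x'\times y),\quad (x+x')\times y=(x\times y)+(x'\times y);$$ but it is not distributive on the right in general.
   Context: A planar binary tree of degree $n\ge 0$ is a planar rooted tree (up to planar isotopy) with $n+1$ leaves in which every internal vertex has exactly two inputs; $Y_n$ is the set of these trees, $Y_0=\{|\}$, and the unique tree of $Y_1$ is denoted $1$. For $x\in Y_p$, $y\in Y_q$ the grafting $x\vee y\in Y_{p+q+1}$ joins the roots of $x$ and $y$ to a new vertex with a new root; every $x\in Y_n$, $n\ge1$, decomposes uniquely as $x=x^l\vee x^r$. Tamari order on $Y_n$: the smallest partial order with $(a\vee b)\vee c\le a\vee(b\vee c)$, and $a\le b\Rightarrow a\vee c\le b\vee c,\ c\vee a\le c\vee b$. $x/y$ identifies the root of $x$ with the leftmost leaf of $y$; $x\backslash y$ identifies the rightmost leaf of $x$ with the root of $y$. Sum of trees: $x+y:=\{z\in Y_{p+q}: x/y\le z\le x\backslash y\}$. A grove is a nonempty subset of some $Y_n$; all operations on groves are extended from trees by distributivity (union over pairs), and grafting with a grove is elementwise. Left/Right sums of trees: $x\dashv y:=x^l\vee(x^r+y)$ for $x\ne|$, $x\vdash y:=(x+y^l)\vee y^r$ for $y\ne|$, $|\dashv y=|=y\vdash|$ for $y\ne|$, and by convention $|\dashv|=|\vdash|=|$. Product: for a tree $x$ and a grove $y$ define $W_|(y):=|$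 and $W_x(y):=(W_{x^l}(y)\vdash y)\dashv W_{x^r}(y)$ for $x=x^l\vee x^r$; set $x\times y:=W_x(y)$ (i.e. $y$ substituted for each copy of $1$ in the expression of $x$ built from copies of $1$), and for a grove $X$, $X\times y:=\bigcup_{x\in X}x\times y$. -}

module Defs where

open import Data.Nat using (ℕ; zero; suc; _+_)
open import Data.Product using (Σ; ∃; ∃-syntax; _×_; _,_)
open import Relation.Binary.PropositionalEquality using (_≡_)

-- Planar binary trees: leaf = | , node l r = l ∨ r
data Tree : Set where
  leaf : Tree
  node : Tree → Tree → Tree

infixr 6 _∨_
_∨_ : Tree → Tree → Tree
_∨_ = node

deg : Tree → ℕ
deg leaf       = zero
deg (node l r) = suc (deg l + deg r)

-- x / y : identify the root of x with the leftmost leaf of y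
_/_ : Tree → Tree → Tree
x / leaf     = x
x / node l r = node (x / l) r

-- x \ y : identify the rightmost leaf of x with the root of y
_\\_ : Tree → Tree → Tree
leaf     \\ y = y
node l r \\ y = node l (r \\ y)

infix 4 _≤T_
data _≤T_ : Tree → Tree → Set where
  ≤-refl  : ∀ {a} → a ≤T a
  ≤-trans : ∀ {a b c} → a ≤T b → b ≤T c → a ≤T c
  ≤-assoc : ∀ {a b c} → (a ∨ b) ∨ c ≤T a ∨ (b ∨ c)
  ≤-left  : ∀ {a b c} → a ≤T b → a ∨ c ≤T b ∨ c
  ≤-right : ∀ {a b c} → a ≤T b → c ∨ a ≤T c ∨ b

Grove : Set₁
Grove = Tree → Set

record IsGrove (X : Grove) : Set where
  field
    nonempty : ∃[ t ] X t
    homogeneous : ∀ {s t} → X s → X t → deg s ≡ deg t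

⟦_⟧ : Tree → Grove
⟦ t ⟧ z = z ≡ t

_+t_ : Tree → Tree → Grove
(x +t y) z = (x / y ≤T z) × (z ≤T x \\ y)

_⊣t_ : Tree → Tree → Grove
leaf       ⊣t y = ⟦ leaf ⟧
(node l r) ⊣t y = λ z → ∃[ w ] ((r +t y) w × z ≡ node l w)

_⊢t_ : Tree → Tree → Grove
x ⊢t leaf       = ⟦ leaf ⟧
x ⊢t (node l r) = λ z → ∃[ w ] ((x +t l) w × z ≡ node w r)

lift : (Tree → Tree → Grove) → Grove → Grove → Grove
lift op X Y z = ∃[ x ] ∃[ y ] (X x × Y y × op x y z)

_+G_ _⊣G_ _⊢G_ : Grove → Grove → Grove
_+G_ = lift _+t_
_⊣G_ = lift _⊣t_
_⊢G_ = lift _⊢t_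

W : Tree → Grove → Grove
W leaf       Y = ⟦ leaf ⟧
W (node l r) Y = (W l Y ⊢G Y) ⊣G W r Y

_×G_ : Grove → Grove → Grove
(X ×G Y) z = ∃[ x ] (X x × W x Y z)

infix 4 _≐_
_≐_ : Grove → Grove → Set
X ≐ Y = ∀ z → (X z → Y z) × (Y z → X z)

-- The interval x + y = [x / y, x \\ y] is exactly the set of shuffles of the
-- right spine of x with the left spine of y: every shuffle lies in the interval,
-- and shuffles are closed under the Tamari rotations that stay below x \\ y
-- (a weight that every rotation strictly increases, together with the way a
-- Tamari chain between two grafts splits at the root, excludes the other
-- rotations). Shuffling is associative, which gives the dendriform relations
-- (x ⊣ y) ⊣ z = x ⊣ (y + z), (x ⊢ y) ⊣ z = x ⊢ (y ⊣ z), x ⊢ (y ⊢ z) = (x + y) ⊢ z;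
-- as W_x(y) is built from y by ⊢ and ⊣, induction on the trees then gives
-- W_{x ∙ x′}(y) = W_x(y) ∙ W_{x′}(y) for ∙ among ⊣, ⊢, + (when y has degree 0,
-- all W_x(y) are just |). On the other side x × 1 = x, so for y = y′ = 1 the
-- grove (x × y) ∙ (x × y′) is x ∙ x, which misses a tree of x × (1 ∙ 1) already
-- for trees x of degree 2.

module Submission where

open import Data.Empty using (⊥-elim)
open import Data.Nat using (ℕ; suc; _+_; _≤_; _<_; s≤s)
import Data.Nat.Properties as ℕ
open import Data.Nat.Tactic.RingSolver using (solve-∀)
open import Data.Product using (∃; ∃-syntax; _×_; _,_; proj₁; proj₂)
open import Data.Sum using (_⊎_; inj₁; inj₂)
open import Data.Unit using (⊤; tt)
open import Relation.Binary.Construct.Closure.ReflexiveTransitive using (Star; ε; _◅_; _◅◅_; gmap)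
open import Relation.Binary.PropositionalEquality using (_≡_; refl; sym; trans; cong; subst)
open import Relation.Nullary using (¬_)

open import Defs

≤T⇒deg≡ : ∀ {a b} → a ≤T b → deg a ≡ deg b
≤T⇒deg≡ ≤-refl        = refl
≤T⇒deg≡ (≤-trans p q) = trans (≤T⇒deg≡ p) (≤T⇒deg≡ q)
≤T⇒deg≡ (≤-assoc {a} {b} {c}) = cong suc (shift (deg a) (deg b) (deg c))
  where
  shift : ∀ x y z → suc (x + y) + z ≡ x + suc (y + z)
  shift = solve-∀
≤T⇒deg≡ (≤-left {c = c} p)  = cong (λ k → suc (k + deg c)) (≤T⇒deg≡ p)
≤T⇒deg≡ (≤-right {c = c} p) = cong (λ k → suc (deg c + k)) (≤T⇒deg≡ p)

deg-/ : ∀ a b → deg (a / b) ≡ deg a + deg b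
deg-/ a leaf       = sym (ℕ.+-identityʳ (deg a))
deg-/ a (node l r) = trans (cong (λ k → suc (k + deg r)) (deg-/ a l)) (shift (deg a) (deg l) (deg r))
  where
  shift : ∀ x y z → suc (x + y + z) ≡ x + suc (y + z)
  shift = solve-∀

deg-\\ : ∀ a b → deg (a \\ b) ≡ deg a + deg b
deg-\\ leaf       b = refl
deg-\\ (node l r) b = cong suc (trans (cong (deg l +_) (deg-\\ r b)) (sym (ℕ.+-assoc (deg l) (deg r) (deg b))))

deg+n≡n⇒leaf : ∀ t n → deg t + n ≡ n → t ≡ leaf
deg+n≡n⇒leaf leaf       n _  = refl
deg+n≡n⇒leaf (node l r) n eq = ⊥-elim (ℕ.<-irrefl (sym eq) (s≤s (ℕ.m≤n+m n (deg l + deg r))))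

IsNode : Tree → Set
IsNode t = ∃[ a ] ∃[ b ] (t ≡ a ∨ b)

0≡deg⇒leaf : ∀ {t} → 0 ≡ deg t → t ≡ leaf
0≡deg⇒leaf {leaf} _ = refl

suc≡deg⇒node : ∀ {t n} → suc n ≡ deg t → IsNode t
suc≡deg⇒node {node a b} _ = a , b , refl

node≰leaf : ∀ {u v} → ¬ (node u v ≤T leaf)
node≰leaf p with ≤T⇒deg≡ p
... | ()

infix 4 _⟶_
data _⟶_ : Tree → Tree → Set where
  rot : ∀ {a b c} → (a ∨ b) ∨ c ⟶ a ∨ (b ∨ c)
  inˡ : ∀ {a b c} → a ⟶ b → a ∨ c ⟶ b ∨ c
  inʳ : ∀ {a b c} → a ⟶ b → c ∨ a ⟶ c ∨ b

⟶⇒≤T : ∀ {a b} → a ⟶ b → a ≤T b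
⟶⇒≤T rot     = ≤-assoc
⟶⇒≤T (inˡ s) = ≤-left (⟶⇒≤T s)
⟶⇒≤T (inʳ s) = ≤-right (⟶⇒≤T s)

⟶*⇒≤T : ∀ {a b} → Star _⟶_ a b → a ≤T b
⟶*⇒≤T ε       = ≤-refl
⟶*⇒≤T (s ◅ r) = ≤-trans (⟶⇒≤T s) (⟶*⇒≤T r)

≤T⇒⟶* : ∀ {a b} → a ≤T b → Star _⟶_ a b
≤T⇒⟶* ≤-refl        = ε
≤T⇒⟶* (≤-trans p q) = ≤T⇒⟶* p ◅◅ ≤T⇒⟶* q
≤T⇒⟶* ≤-assoc       = rot ◅ ε
≤T⇒⟶* (≤-left p)    = gmap _ inˡ (≤T⇒⟶* p)
≤T⇒⟶* (≤-right p)   = gmap _ inʳ (≤T⇒⟶* p)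

-- A rotation (a ∨ b) ∨ c ⟶ a ∨ (b ∨ c) raises the weight by 1 + deg c,
-- so no Tamari chain can undo a rotation.
weight : Tree → ℕ
weight leaf       = 0
weight (node l r) = weight l + deg r + weight r

weight-⟶ : ∀ {a b} → a ⟶ b → weight a < weight b
weight-⟶ (rot {a} {b} {c}) =
  subst (suc (weight ((a ∨ b) ∨ c)) ≤_) (raise (weight a) (deg b) (weight b) (deg c) (weight c)) (ℕ.m≤m+n _ (deg c))
  where
  raise : ∀ wa db wb dc wc → suc (wa + db + wb + dc + wc) + dc ≡ wa + suc (db + dc) + (wb + dc + wc)
  raise = solve-∀
weight-⟶ (inˡ {c = c} s) = ℕ.+-monoˡ-< (weight c) (ℕ.+-monoˡ-< (deg c) (weight-⟶ s))
weight-⟶ (inʳ {c = c} s) =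
  ℕ.+-mono-≤-< (ℕ.+-monoʳ-≤ (weight c) (ℕ.≤-reflexive (≤T⇒deg≡ (⟶⇒≤T s)))) (weight-⟶ s)

weight-mono : ∀ {a b} → a ≤T b → weight a ≤ weight b
weight-mono p = along (≤T⇒⟶* p)
  where
  along : ∀ {a b} → Star _⟶_ a b → weight a ≤ weight b
  along ε       = ℕ.≤-refl
  along (s ◅ r) = ℕ.≤-trans (ℕ.<⇒≤ (weight-⟶ s)) (along r)

⟶⇒≱T : ∀ {a b} → a ⟶ b → ¬ (b ≤T a)
⟶⇒≱T s b≤a = ℕ.<⇒≱ (weight-⟶ s) (weight-mono b≤a)

infixr 5 _⋉_
_⋉_ : Tree → Tree → Tree
leaf     ⋉ q = q
node t u ⋉ q = t ⋉ (u ∨ q)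

deg-⋉ : ∀ t q → deg (t ⋉ q) ≡ deg t + deg q
deg-⋉ leaf       q = refl
deg-⋉ (node t u) q = trans (deg-⋉ t (u ∨ q)) (shift (deg t) (deg u) (deg q))
  where
  shift : ∀ x y z → x + suc (y + z) ≡ suc (x + y + z)
  shift = solve-∀

deg≤deg-⋉ : ∀ t q → deg q ≤ deg (t ⋉ q)
deg≤deg-⋉ t q = subst (deg q ≤_) (sym (deg-⋉ t q)) (ℕ.m≤n+m (deg q) (deg t))

deg≤deg-/ : ∀ a t → deg a ≤ deg (a / t)
deg≤deg-/ a t = subst (deg a ≤_) (sym (deg-/ a t)) (ℕ.m≤m+n (deg a) (deg t))

deg≤deg-\\ : ∀ y q → deg q ≤ deg (y \\ q)
deg≤deg-\\ y q = subst (deg q ≤_) (sym (deg-\\ y q)) (ℕ.m≤n+m (deg q) (deg y))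

/-assoc : ∀ a b c → (a / b) / c ≡ a / (b / c)
/-assoc a b leaf       = refl
/-assoc a b (node l r) = cong (_∨ r) (/-assoc a b l)

/-monoˡ : ∀ {a a′} t → a ≤T a′ → a / t ≤T a′ / t
/-monoˡ leaf       p = p
/-monoˡ (node l r) p = ≤-left (/-monoˡ l p)

⋉-monoʳ : ∀ {q q′} t → q ≤T q′ → t ⋉ q ≤T t ⋉ q′
⋉-monoʳ leaf       p = p
⋉-monoʳ (node t u) p = ⋉-monoʳ t (≤-right p)

⋉-/ : ∀ s t q → (s / t) ⋉ q ≡ s ⋉ (t ⋉ q)
⋉-/ s leaf       q = refl
⋉-/ s (node t u) q = ⋉-/ s t (u ∨ q)

⋉-\\ : ∀ s q d → (s ⋉ q) \\ d ≡ s ⋉ (q \\ d)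
⋉-\\ leaf       q d = refl
⋉-\\ (node s t) q d = ⋉-\\ s (t ∨ q) d

∨-/≤∨-⋉ : ∀ p t q → (p / t) ∨ q ≤T p ∨ (t ⋉ q)
∨-/≤∨-⋉ p leaf       q = ≤-refl
∨-/≤∨-⋉ p (node t u) q = ≤-trans ≤-assoc (∨-/≤∨-⋉ p t (u ∨ q))

-- Along a Tamari chain from u ∨ v to u′ ∨ v′, what crosses the root is a
-- piece t of the left spine of u′, and then u ≤ u′ / t and t ⋉ v ≤ v′.
RootSplit : Tree → Tree → Set
RootSplit (node u v) (node u′ v′) = ∃[ t ] (u ≤T u′ / t × t ⋉ v ≤T v′)
RootSplit _          _            = ⊤

private
  RootSplit-refl : ∀ a → RootSplit a a
  RootSplit-refl leaf       = tt
  RootSplit-refl (node u v) = leaf , ≤-refl , ≤-refl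

  RootSplit-trans : ∀ a b c → a ≤T b → RootSplit a b → RootSplit b c → RootSplit a c
  RootSplit-trans leaf       _          _          _   _ _ = tt
  RootSplit-trans (node u v) leaf       leaf       _   _ _ = tt
  RootSplit-trans (node u v) leaf       (node _ _) a≤b _ _ = ⊥-elim (node≰leaf a≤b)
  RootSplit-trans (node u v) (node _ _) leaf       _   _ _ = tt
  RootSplit-trans (node u v) (node m n) (node u′ v′) _ (t , u≤ , ≤n) (s , m≤ , ≤v′) =
    s / t ,
    ≤-trans u≤ (subst (m / t ≤T_) (/-assoc u′ s t) (/-monoˡ t m≤)) ,
    subst (_≤T v′) (sym (⋉-/ s t v)) (≤-trans (⋉-monoʳ s ≤n) ≤v′)

  ≤T⇒RootSplit : ∀ {a b} → a ≤T b → RootSplit a b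
  ≤T⇒RootSplit {a} ≤-refl = RootSplit-refl a
  ≤T⇒RootSplit (≤-trans {a} {b} {c} p q) = RootSplit-trans a b c p (≤T⇒RootSplit p) (≤T⇒RootSplit q)
  ≤T⇒RootSplit (≤-assoc {b = b}) = leaf ∨ b , ≤-refl , ≤-refl
  ≤T⇒RootSplit (≤-left p)  = leaf , p , ≤-refl
  ≤T⇒RootSplit (≤-right p) = leaf , ≤-refl , p

∨-≤T-split : ∀ {u v u′ v′} → u ∨ v ≤T u′ ∨ v′ → ∃[ t ] (u ≤T u′ / t × t ⋉ v ≤T v′)
∨-≤T-split = ≤T⇒RootSplit

∨-≤T-∨-cancel : ∀ {u v u′ v′} → deg v ≡ deg v′ → u ∨ v ≤T u′ ∨ v′ → u ≤T u′ × v ≤T v′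
∨-≤T-∨-cancel {v = v} dv p with ∨-≤T-split p
... | t , u≤ , ≤v′ with deg+n≡n⇒leaf t (deg v) (trans (sym (deg-⋉ t v)) (trans (≤T⇒deg≡ ≤v′) (sym dv)))
... | refl = u≤ , ≤v′

<deg⇒≰T : ∀ {a b} → deg a < deg b → ¬ (a ≤T b)
<deg⇒≰T lt p = ℕ.<-irrefl (≤T⇒deg≡ p) lt

>deg⇒≰T : ∀ {a b} → deg b < deg a → ¬ (a ≤T b)
>deg⇒≰T lt p = ℕ.<-irrefl (sym (≤T⇒deg≡ p)) lt

deg<deg-\\∨ : ∀ y p e → deg e < deg (y \\ (p ∨ e))
deg<deg-\\∨ y p e = ℕ.<-≤-trans (s≤s (ℕ.m≤n+m (deg e) (deg p))) (deg≤deg-\\ y (p ∨ e))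

\\-∨-≤T-∨⇒leaf : ∀ Y p e c f → deg f ≤ deg e → Y \\ (p ∨ e) ≤T c ∨ f → Y ≡ leaf
\\-∨-≤T-∨⇒leaf leaf         p e c f _   _ = refl
\\-∨-≤T-∨⇒leaf (node y₁ y₂) p e c f f≤e h with ∨-≤T-split h
... | t , _ , ≤f = ⊥-elim (>deg⇒≰T (ℕ.<-≤-trans (ℕ.≤-<-trans f≤e (deg<deg-\\∨ y₂ p e)) (deg≤deg-⋉ t _)) ≤f)

\\-∨-descend : ∀ Y p e a b z → deg e < deg z → Y \\ (p ∨ e) ≤T (a ∨ b) \\ z →
  ∃[ Y′ ] ∃[ p′ ] (Y′ \\ (p′ ∨ e) ≤T b \\ z × (∀ {r} → Y′ \\ p′ ≤T r → Y \\ p ≤T a ∨ r))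
\\-∨-descend leaf p e a b z e<z h with ∨-≤T-split h
... | leaf , _ , e≤ = ⊥-elim (<deg⇒≰T (ℕ.<-≤-trans e<z (deg≤deg-\\ b z)) e≤)
... | node u₁ u₂ , p≤ , ≤bz =
  u₁ ⋉ leaf , u₂ , subst (_≤T b \\ z) (sym (⋉-\\ u₁ leaf (u₂ ∨ e))) ≤bz ,
  λ q → ≤-trans p≤ (≤-trans (∨-/≤∨-⋉ a u₁ u₂) (≤-right (subst (_≤T _) (⋉-\\ u₁ leaf u₂) q)))
\\-∨-descend (node y₁ y₂) p e a b z _ h with ∨-≤T-split h
... | s , y₁≤ , ≤bz =
  s ⋉ y₂ , p , subst (_≤T b \\ z) (sym (⋉-\\ s y₂ (p ∨ e))) ≤bz ,
  λ q → ≤-trans (≤-left y₁≤) (≤-trans (∨-/≤∨-⋉ a s (y₂ \\ p)) (≤-right (subst (_≤T _) (⋉-\\ s y₂ p) q)))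

\\-∨-cancel : ∀ X Y p e c f → deg e ≡ deg f → Y \\ (p ∨ e) ≤T X \\ (c ∨ f) → Y \\ p ≤T X \\ c × e ≤T f
\\-∨-cancel leaf Y p e c f de h with \\-∨-≤T-∨⇒leaf Y p e c f (ℕ.≤-reflexive (sym de)) h
... | refl = ∨-≤T-∨-cancel de h
\\-∨-cancel (node a b) Y p e c f de h
  with \\-∨-descend Y p e a b (c ∨ f) (s≤s (subst (_≤ deg c + deg f) (sym de) (ℕ.m≤n+m _ _))) h
... | Y′ , p′ , below , lift with \\-∨-cancel b Y′ p′ e c f de below
... | p≤ , e≤f = lift p≤ , e≤f

\\-∨∨-≰T-unrotated : ∀ X Y p q e c → deg Y + deg p ≡ deg X + deg c →
  ¬ (Y \\ (p ∨ (q ∨ e)) ≤T X \\ ((c ∨ q) ∨ e))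
\\-∨∨-≰T-unrotated leaf Y p q e c dd h
  with \\-∨-≤T-∨⇒leaf Y p (q ∨ e) (c ∨ q) e (ℕ.m≤n+m (deg e) (suc (deg q))) h
... | refl with ∨-≤T-split h
... | t , p≤ , _ =
  <deg⇒≰T (subst (_< deg ((c ∨ q) / t)) (sym dd) (ℕ.<-≤-trans (s≤s (ℕ.m≤m+n _ _)) (deg≤deg-/ (c ∨ q) t))) p≤
\\-∨∨-≰T-unrotated (node a b) Y p q e c dd h
  with \\-∨-descend Y p (q ∨ e) a b ((c ∨ q) ∨ e) (s≤s (s≤s (ℕ.+-monoˡ-≤ (deg e) (ℕ.m≤n+m (deg q) (deg c))))) h
... | Y′ , p′ , below , lift = \\-∨∨-≰T-unrotated b Y′ p′ q e c deg-rest below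
  where
  peel : ∀ A B C D → suc (A + D) ≡ suc (A + B) + C → D ≡ B + C
  peel A B C D eq = ℕ.+-cancelˡ-≡ A _ _ (ℕ.suc-injective (trans eq (cong suc (ℕ.+-assoc A B C))))
  deg-rest : deg Y′ + deg p′ ≡ deg b + deg c
  deg-rest = peel (deg a) (deg b) (deg c) _
    (trans (cong (λ k → suc (deg a + k)) (sym (deg-\\ Y′ p′)))
      (trans (sym (≤T⇒deg≡ (lift ≤-refl))) (trans (deg-\\ Y p) dd)))

-- The paper's recursive description x + y = x^l ∨ (x^r + y) ∪ (x + y^l) ∨ y^r:
-- z interleaves the right spine of x with the left spine of y.
data Shuffle : Tree → Tree → Tree → Set where
  leaves : Shuffle leaf leaf leaf
  takeˡ  : ∀ {a b y w} → Shuffle b y w → Shuffle (a ∨ b) y (a ∨ w)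
  takeʳ  : ∀ {x c d w} → Shuffle x c w → Shuffle x (c ∨ d) (w ∨ d)

deg-Shuffle : ∀ {x y z} → Shuffle x y z → deg z ≡ deg x + deg y
deg-Shuffle leaves = refl
deg-Shuffle (takeˡ {a} {b} {y} h) = cong suc (trans (cong (deg a +_) (deg-Shuffle h)) (sym (ℕ.+-assoc (deg a) (deg b) (deg y))))
deg-Shuffle (takeʳ {x} {c} {d} h) = trans (cong (λ k → suc (k + deg d)) (deg-Shuffle h)) (shift (deg x) (deg c) (deg d))
  where
  shift : ∀ p q r → suc (p + q + r) ≡ p + suc (q + r)
  shift = solve-∀

Shuffle-leafʳ : ∀ x → Shuffle x leaf x
Shuffle-leafʳ leaf       = leaves
Shuffle-leafʳ (node a b) = takeˡ (Shuffle-leafʳ b)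

Shuffle-leafˡ : ∀ y → Shuffle leaf y y
Shuffle-leafˡ leaf       = leaves
Shuffle-leafˡ (node c d) = takeʳ (Shuffle-leafˡ c)

Shuffle-leafʳ-unique : ∀ {x z} → Shuffle x leaf z → z ≡ x
Shuffle-leafʳ-unique leaves    = refl
Shuffle-leafʳ-unique (takeˡ h) = cong (node _) (Shuffle-leafʳ-unique h)

Shuffle-leafˡ-unique : ∀ {y z} → Shuffle leaf y z → z ≡ y
Shuffle-leafˡ-unique leaves    = refl
Shuffle-leafˡ-unique (takeʳ h) = cong (_∨ _) (Shuffle-leafˡ-unique h)

Shuffle-/ : ∀ x y → Shuffle x y (x / y)
Shuffle-/ x leaf       = Shuffle-leafʳ x
Shuffle-/ x (node c d) = takeʳ (Shuffle-/ x c)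

Shuffle⇒+t : ∀ {x y z} → Shuffle x y z → (x +t y) z
Shuffle⇒+t leaves = ≤-refl , ≤-refl
Shuffle⇒+t (takeˡ {a} {b} {y} h) = ≤-trans (∨-/ a b y) (≤-right (proj₁ (Shuffle⇒+t h))) , ≤-right (proj₂ (Shuffle⇒+t h))
  where
  ∨-/ : ∀ a b y → (a ∨ b) / y ≤T a ∨ (b / y)
  ∨-/ a b leaf       = ≤-refl
  ∨-/ a b (node c d) = ≤-trans (≤-left (∨-/ a b c)) ≤-assoc
Shuffle⇒+t (takeʳ {x} {c} {d} h) = ≤-left (proj₁ (Shuffle⇒+t h)) , ≤-trans (≤-left (proj₂ (Shuffle⇒+t h))) (\\-∨ x c d)
  where
  \\-∨ : ∀ x c d → (x \\ c) ∨ d ≤T x \\ (c ∨ d)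
  \\-∨ leaf       c d = ≤-refl
  \\-∨ (node l r) c d = ≤-trans ≤-assoc (≤-right (\\-∨ r c d))

-- A rotation other than the one exchanging a vertex of x with a vertex of y
-- alters x or y themselves, which the upper bound x \\ y forbids.
Shuffle-⟶ : ∀ {x y w w′} → Shuffle x y w → w ⟶ w′ → w′ ≤T x \\ y → Shuffle x y w′
Shuffle-⟶ (takeˡ {node a a′} h) rot bound with ∨-≤T-split bound
... | t , a≤ , _ = ⊥-elim (<deg⇒≰T (ℕ.<-≤-trans (s≤s (ℕ.m≤m+n _ _)) (deg≤deg-/ (a ∨ a′) t)) a≤)
Shuffle-⟶ (takeˡ {b = b} {y} h) (inˡ s) bound =
  ⊥-elim (⟶⇒≱T s (proj₁ (∨-≤T-∨-cancel (trans (deg-Shuffle h) (sym (deg-\\ b y))) bound)))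
Shuffle-⟶ (takeˡ {b = b} {y} h) (inʳ s) bound =
  takeˡ (Shuffle-⟶ h s (proj₂ (∨-≤T-∨-cancel
    (trans (sym (≤T⇒deg≡ (⟶⇒≤T s))) (trans (deg-Shuffle h) (sym (deg-\\ b y)))) bound)))
Shuffle-⟶ (takeʳ (takeˡ h)) rot _ = takeˡ (takeʳ h)
Shuffle-⟶ (takeʳ {x} {node c q} {e} (takeʳ {w = w} h)) rot bound =
  ⊥-elim (\\-∨∨-≰T-unrotated x leaf w q e c (deg-Shuffle h) bound)
Shuffle-⟶ (takeʳ {x} {c} {d} h) (inˡ s) bound =
  takeʳ (Shuffle-⟶ h s (proj₁ (\\-∨-cancel x leaf _ d c d refl bound)))
Shuffle-⟶ (takeʳ {x} {c} {d} h) (inʳ s) bound =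
  ⊥-elim (⟶⇒≱T s (proj₂ (\\-∨-cancel x leaf _ _ c d (sym (≤T⇒deg≡ (⟶⇒≤T s))) bound)))

+t⇒Shuffle : ∀ {x y z} → (x +t y) z → Shuffle x y z
+t⇒Shuffle {x} {y} {z} (lower , upper) = along (Shuffle-/ x y) (≤T⇒⟶* lower)
  where
  along : ∀ {w} → Shuffle x y w → Star _⟶_ w z → Shuffle x y z
  along h ε       = h
  along h (s ◅ r) = along (Shuffle-⟶ h s (≤-trans (⟶*⇒≤T r) upper)) r

Shuffle-assocʳ : ∀ {p q w r z} → Shuffle p q w → Shuffle w r z → ∃[ v ] (Shuffle q r v × Shuffle p v z)
Shuffle-assocʳ leaves    leaves    = leaf , leaves , leaves
Shuffle-assocʳ h         (takeʳ k) with Shuffle-assocʳ h k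
... | v , h′ , k′ = _ , takeʳ h′ , takeʳ k′
Shuffle-assocʳ (takeˡ h) (takeˡ k) with Shuffle-assocʳ h k
... | v , h′ , k′ = v , h′ , takeˡ k′
Shuffle-assocʳ (takeʳ h) (takeˡ k) = _ , takeˡ k , takeʳ h

Shuffle-assocˡ : ∀ {q r v p z} → Shuffle q r v → Shuffle p v z → ∃[ w ] (Shuffle p q w × Shuffle w r z)
Shuffle-assocˡ leaves    leaves    = leaf , leaves , leaves
Shuffle-assocˡ h         (takeˡ k) with Shuffle-assocˡ h k
... | w , h′ , k′ = _ , takeˡ h′ , takeˡ k′
Shuffle-assocˡ (takeˡ h) (takeʳ k) = _ , takeʳ k , takeˡ h
Shuffle-assocˡ (takeʳ h) (takeʳ k) with Shuffle-assocˡ h k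
... | w , h′ , k′ = w , h′ , takeʳ k′

+t-nonempty : ∀ a b → ∃ (a +t b)
+t-nonempty a b = a / b , Shuffle⇒+t (Shuffle-/ a b)

⊣t-nonempty : ∀ a b → ∃ (a ⊣t b)
⊣t-nonempty leaf       b = leaf , refl
⊣t-nonempty (node l r) b = l ∨ (r / b) , r / b , +t-nonempty r b .proj₂ , refl

⊢t-nonempty : ∀ a b → ∃ (a ⊢t b)
⊢t-nonempty a leaf       = leaf , refl
⊢t-nonempty a (node l r) = (a / l) ∨ r , a / l , +t-nonempty a l .proj₂ , refl

⊣t⇒+t : ∀ a b y {z} → ((a ∨ b) ⊣t y) z → ((a ∨ b) +t y) z
⊣t⇒+t _ _ _ (w , w∈ , refl) = Shuffle⇒+t (takeˡ (+t⇒Shuffle w∈))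

⊢t⇒+t : ∀ x c d {z} → (x ⊢t (c ∨ d)) z → (x +t (c ∨ d)) z
⊢t⇒+t _ _ _ (w , w∈ , refl) = Shuffle⇒+t (takeʳ (+t⇒Shuffle w∈))

∨+t∨⇒⊣t⊎⊢t : ∀ a b c d {z} → ((a ∨ b) +t (c ∨ d)) z → ((a ∨ b) ⊣t (c ∨ d)) z ⊎ ((a ∨ b) ⊢t (c ∨ d)) z
∨+t∨⇒⊣t⊎⊢t a b c d z∈ with +t⇒Shuffle {a ∨ b} {c ∨ d} z∈
... | takeˡ h = inj₁ (_ , Shuffle⇒+t h , refl)
... | takeʳ h = inj₂ (_ , Shuffle⇒+t h , refl)

DistribAt : Grove → (Tree → Tree → Grove) → Tree → Tree → Set
DistribAt Y _∙_ u u′ = (u ∙ u′) ×G Y ≐ lift _∙_ (W u Y) (W u′ Y)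

Distributes : Grove → (Tree → Tree → Grove) → Set
Distributes Y _∙_ = ∀ u u′ → DistribAt Y _∙_ u u′

×G-distribʳ-lift : ∀ Y _∙_ → Distributes Y _∙_ → ∀ X X′ → lift _∙_ X X′ ×G Y ≐ lift _∙_ (X ×G Y) (X′ ×G Y)
×G-distribʳ-lift Y _∙_ dist X X′ z = to , from
  where
  to : (lift _∙_ X X′ ×G Y) z → lift _∙_ (X ×G Y) (X′ ×G Y) z
  to (t , (u , u′ , u∈ , u′∈ , t∈) , z∈) with proj₁ (dist u u′ z) (t , t∈ , z∈)
  ... | p , q , p∈ , q∈ , z∈pq = p , q , (u , u∈ , p∈) , (u′ , u′∈ , q∈) , z∈pq
  from : lift _∙_ (X ×G Y) (X′ ×G Y) z → (lift _∙_ X X′ ×G Y) z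
  from (p , q , (u , u∈ , p∈) , (u′ , u′∈ , q∈) , z∈pq) with proj₂ (dist u u′ z) (p , q , p∈ , q∈ , z∈pq)
  ... | t , t∈ , z∈ = t , (u , u′ , u∈ , u′∈ , t∈) , z∈

W-nonempty : ∀ {Y y₀} → Y y₀ → ∀ t → ∃ (W t Y)
W-nonempty y₀∈ leaf = leaf , refl
W-nonempty {y₀ = y₀} y₀∈ (node l r) with W-nonempty y₀∈ l | W-nonempty y₀∈ r
... | p , p∈ | q , q∈ with ⊢t-nonempty p y₀
... | p′ , p′∈ with ⊣t-nonempty p′ q
... | z , z∈ = z , p′ , q , (p , y₀ , p∈ , y₀∈ , p′∈) , q∈ , z∈

distrib-⊣-leaf : ∀ {Y y₀} → Y y₀ → ∀ u′ → DistribAt Y _⊣t_ leaf u′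
distrib-⊣-leaf {Y} y₀∈ u′ z = to , from
  where
  to : ((leaf ⊣t u′) ×G Y) z → lift _⊣t_ (W leaf Y) (W u′ Y) z
  to (_ , refl , z∈) = leaf , proj₁ (W-nonempty y₀∈ u′) , refl , proj₂ (W-nonempty y₀∈ u′) , z∈
  from : lift _⊣t_ (W leaf Y) (W u′ Y) z → ((leaf ⊣t u′) ×G Y) z
  from (_ , _ , refl , _ , z∈) = leaf , refl , z∈

distrib-⊢-leaf : ∀ {Y y₀} → Y y₀ → ∀ u → DistribAt Y _⊢t_ u leaf
distrib-⊢-leaf {Y} y₀∈ u z = to , from
  where
  to : ((u ⊢t leaf) ×G Y) z → lift _⊢t_ (W u Y) (W leaf Y) z
  to (_ , refl , z∈) = proj₁ (W-nonempty y₀∈ u) , leaf , proj₂ (W-nonempty y₀∈ u) , refl , z∈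
  from : lift _⊢t_ (W u Y) (W leaf Y) z → ((u ⊢t leaf) ×G Y) z
  from (_ , _ , _ , refl , z∈) = leaf , refl , z∈

distrib-+-leafˡ : ∀ Y u′ → DistribAt Y _+t_ leaf u′
distrib-+-leafˡ Y u′ z = to , from
  where
  to : ((leaf +t u′) ×G Y) z → lift _+t_ (W leaf Y) (W u′ Y) z
  to (t , t∈ , z∈) with Shuffle-leafˡ-unique (+t⇒Shuffle {leaf} {u′} t∈)
  ... | refl = leaf , z , refl , z∈ , Shuffle⇒+t (Shuffle-leafˡ z)
  from : lift _+t_ (W leaf Y) (W u′ Y) z → ((leaf +t u′) ×G Y) z
  from (_ , q , refl , q∈ , z∈) with Shuffle-leafˡ-unique (+t⇒Shuffle {leaf} {q} z∈)
  ... | refl = u′ , Shuffle⇒+t (Shuffle-leafˡ u′) , q∈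

distrib-+-leafʳ : ∀ Y u → DistribAt Y _+t_ u leaf
distrib-+-leafʳ Y u z = to , from
  where
  to : ((u +t leaf) ×G Y) z → lift _+t_ (W u Y) (W leaf Y) z
  to (t , t∈ , z∈) with Shuffle-leafʳ-unique (+t⇒Shuffle {u} {leaf} t∈)
  ... | refl = z , leaf , z∈ , refl , Shuffle⇒+t (Shuffle-leafʳ z)
  from : lift _+t_ (W u Y) (W leaf Y) z → ((u +t leaf) ×G Y) z
  from (p , _ , p∈ , refl , z∈) with Shuffle-leafʳ-unique (+t⇒Shuffle {p} {leaf} z∈)
  ... | refl = u , Shuffle⇒+t (Shuffle-leafʳ u) , p∈

module LeafGrove (Y : Grove) (only-leaf : ∀ {t} → Y t → t ≡ leaf) (leaf∈Y : Y leaf) where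

  W≡leaf : ∀ t {z} → W t Y z → z ≡ leaf
  W≡leaf leaf       z∈ = z∈
  W≡leaf (node l r) (_ , _ , (_ , _ , _ , y∈ , p∈) , _ , z∈) with only-leaf y∈
  ... | refl with p∈
  ... | refl = z∈

  leaf∈W : ∀ t → W t Y leaf
  leaf∈W leaf       = refl
  leaf∈W (node l r) = leaf , leaf , (leaf , leaf , leaf∈W l , leaf∈Y , refl) , leaf∈W r , refl

  distributes : ∀ _∙_ → (∀ u u′ → ∃ (u ∙ u′)) → (leaf ∙ leaf) ≐ ⟦ leaf ⟧ → Distributes Y _∙_
  distributes _∙_ nonempty unit u u′ z = to , from
    where
    to : ((u ∙ u′) ×G Y) z → lift _∙_ (W u Y) (W u′ Y) z
    to (t , _ , z∈) with W≡leaf t z∈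
    ... | refl = leaf , leaf , leaf∈W u , leaf∈W u′ , proj₂ (unit leaf) refl
    from : lift _∙_ (W u Y) (W u′ Y) z → ((u ∙ u′) ×G Y) z
    from (_ , _ , p∈ , q∈ , z∈) with W≡leaf u p∈ | W≡leaf u′ q∈
    ... | refl | refl with proj₁ (unit z) z∈
    ... | refl = proj₁ (nonempty u u′) , proj₂ (nonempty u u′) , leaf∈W (proj₁ (nonempty u u′))

-- W (l ∨ r) Y = (W l Y ⊢ Y) ⊣ W r Y, unfolded into shuffles for a node y₁ ∨ y₂ of Y.
data W∨ (Y : Grove) (l r : Tree) : Tree → Set where
  w∨ : ∀ {p y₁ y₂ q w m} → W l Y p → Y (y₁ ∨ y₂) → W r Y q →
       Shuffle p y₁ w → Shuffle y₂ q m → W∨ Y l r (w ∨ m)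

W∨⇒W : ∀ {Y} l r {z} → W∨ Y l r z → W (l ∨ r) Y z
W∨⇒W _ _ (w∨ p∈ y∈ q∈ sw sm) = _ , _ , (_ , _ , p∈ , y∈ , (_ , Shuffle⇒+t sw , refl)) , q∈ , (_ , Shuffle⇒+t sm , refl)

module NodeGrove (Y : Grove) (only-nodes : ∀ {t} → Y t → IsNode t) {y₀ : Tree} (y₀∈Y : Y y₀) where

  W⇒W∨ : ∀ l r {z} → W (l ∨ r) Y z → W∨ Y l r z
  W⇒W∨ _ _ (_ , _ , (_ , _ , p∈ , y∈ , ⊢∈) , q∈ , ⊣∈) with only-nodes y∈
  ... | _ , _ , refl with ⊢∈
  ... | _ , w∈ , refl with ⊣∈
  ... | _ , m∈ , refl = w∨ p∈ y∈ q∈ (+t⇒Shuffle w∈) (+t⇒Shuffle m∈)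

  W-∨-IsNode : ∀ l r {z} → W (l ∨ r) Y z → IsNode z
  W-∨-IsNode l r z∈ with W⇒W∨ l r z∈
  ... | w∨ _ _ _ _ _ = _ , _ , refl

  distrib-⊣-∨ : ∀ l r u′ → DistribAt Y _+t_ r u′ → DistribAt Y _⊣t_ (l ∨ r) u′
  distrib-⊣-∨ l r u′ dist z = to , from
    where
    to : (((l ∨ r) ⊣t u′) ×G Y) z → lift _⊣t_ (W (l ∨ r) Y) (W u′ Y) z
    to (_ , (w′ , w′∈ , refl) , z∈) with W⇒W∨ l w′ z∈
    ... | w∨ p∈ y∈ q∈ sw sm with proj₁ (dist _) (w′ , w′∈ , q∈)
    ... | _ , _ , a∈ , b∈ , q∈ab with Shuffle-assocˡ (+t⇒Shuffle q∈ab) sm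
    ... | _ , s₁ , s₂ = _ , _ , W∨⇒W l r (w∨ p∈ y∈ a∈ sw s₁) , b∈ , (_ , Shuffle⇒+t s₂ , refl)
    from : lift _⊣t_ (W (l ∨ r) Y) (W u′ Y) z → (((l ∨ r) ⊣t u′) ×G Y) z
    from (_ , _ , P∈ , Q∈ , z∈PQ) with W⇒W∨ l r P∈
    ... | w∨ p∈ y∈ a∈ sw sa with z∈PQ
    ... | _ , m∈ , refl with Shuffle-assocʳ sa (+t⇒Shuffle m∈)
    ... | _ , s₁ , s₂ with proj₂ (dist _) (_ , _ , a∈ , Q∈ , Shuffle⇒+t s₁)
    ... | w′ , w′∈ , v∈ = l ∨ w′ , (w′ , w′∈ , refl) , W∨⇒W l w′ (w∨ p∈ y∈ v∈ sw s₂)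

  distrib-⊢-∨ : ∀ u l′ r′ → DistribAt Y _+t_ u l′ → DistribAt Y _⊢t_ u (l′ ∨ r′)
  distrib-⊢-∨ u l′ r′ dist z = to , from
    where
    to : ((u ⊢t (l′ ∨ r′)) ×G Y) z → lift _⊢t_ (W u Y) (W (l′ ∨ r′) Y) z
    to (_ , (w′ , w′∈ , refl) , z∈) with W⇒W∨ w′ r′ z∈
    ... | w∨ p∈ y∈ q∈ sw sm with proj₁ (dist _) (w′ , w′∈ , p∈)
    ... | _ , _ , a∈ , b∈ , p∈ab with Shuffle-assocʳ (+t⇒Shuffle p∈ab) sw
    ... | _ , s₁ , s₂ = _ , _ , a∈ , W∨⇒W l′ r′ (w∨ b∈ y∈ q∈ s₁ sm) , (_ , Shuffle⇒+t s₂ , refl)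
    from : lift _⊢t_ (W u Y) (W (l′ ∨ r′) Y) z → ((u ⊢t (l′ ∨ r′)) ×G Y) z
    from (_ , _ , A∈ , V∈ , z∈AV) with W⇒W∨ l′ r′ V∈
    ... | w∨ b∈ y∈ q∈ sv sm with z∈AV
    ... | _ , w∈ , refl with Shuffle-assocˡ sv (+t⇒Shuffle w∈)
    ... | _ , s₁ , s₂ with proj₂ (dist _) (_ , _ , A∈ , b∈ , Shuffle⇒+t s₁)
    ... | w′ , w′∈ , p∈ = w′ ∨ r′ , (w′ , w′∈ , refl) , W∨⇒W w′ r′ (w∨ p∈ y∈ q∈ s₂ sm)

  distrib-+-∨∨ : ∀ a b c d → DistribAt Y _⊣t_ (a ∨ b) (c ∨ d) → DistribAt Y _⊢t_ (a ∨ b) (c ∨ d) →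
                 DistribAt Y _+t_ (a ∨ b) (c ∨ d)
  distrib-+-∨∨ a b c d dist⊣ dist⊢ z = to , from
    where
    to : (((a ∨ b) +t (c ∨ d)) ×G Y) z → lift _+t_ (W (a ∨ b) Y) (W (c ∨ d) Y) z
    to (t , t∈ , z∈) with ∨+t∨⇒⊣t⊎⊢t a b c d t∈
    ... | inj₁ t∈⊣ with proj₁ (dist⊣ z) (t , t∈⊣ , z∈)
    ...   | p , q , p∈ , q∈ , z∈pq with W-∨-IsNode a b p∈
    ...     | p₁ , p₂ , refl = p , q , p∈ , q∈ , ⊣t⇒+t p₁ p₂ q z∈pq
    to (t , t∈ , z∈) | inj₂ t∈⊢ with proj₁ (dist⊢ z) (t , t∈⊢ , z∈)
    ...   | p , q , p∈ , q∈ , z∈pq with W-∨-IsNode c d q∈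
    ...     | q₁ , q₂ , refl = p , q , p∈ , q∈ , ⊢t⇒+t p q₁ q₂ z∈pq
    from : lift _+t_ (W (a ∨ b) Y) (W (c ∨ d) Y) z → (((a ∨ b) +t (c ∨ d)) ×G Y) z
    from (p , q , p∈ , q∈ , z∈pq) with W-∨-IsNode a b p∈ | W-∨-IsNode c d q∈
    ... | p₁ , p₂ , refl | q₁ , q₂ , refl with ∨+t∨⇒⊣t⊎⊢t p₁ p₂ q₁ q₂ z∈pq
    ...   | inj₁ z∈⊣ with proj₂ (dist⊣ z) (p , q , p∈ , q∈ , z∈⊣)
    ...     | t , t∈ , z∈ = t , ⊣t⇒+t a b (c ∨ d) t∈ , z∈
    from (p , q , p∈ , q∈ , z∈pq) | p₁ , p₂ , refl | q₁ , q₂ , refl | inj₂ z∈⊢ with proj₂ (dist⊢ z) (p , q , p∈ , q∈ , z∈⊢)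
    ...     | t , t∈ , z∈ = t , ⊢t⇒+t (a ∨ b) c d t∈ , z∈

  distrib-+ : Distributes Y _+t_
  distrib-+ leaf       u′         = distrib-+-leafˡ Y u′
  distrib-+ (node a b) leaf       = distrib-+-leafʳ Y (a ∨ b)
  distrib-+ (node a b) (node c d) =
    distrib-+-∨∨ a b c d (distrib-⊣-∨ a b _ (distrib-+ b (node c d))) (distrib-⊢-∨ _ c d (distrib-+ (node a b) c))

  distrib-⊣ : Distributes Y _⊣t_
  distrib-⊣ leaf       u′ = distrib-⊣-leaf y₀∈Y u′
  distrib-⊣ (node l r) u′ = distrib-⊣-∨ l r u′ (distrib-+ r u′)

  distrib-⊢ : Distributes Y _⊢t_
  distrib-⊢ u leaf         = distrib-⊢-leaf y₀∈Y u
  distrib-⊢ u (node l′ r′) = distrib-⊢-∨ u l′ r′ (distrib-+ u l′)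

W-distrib : ∀ {Y} → IsGrove Y → Distributes Y _⊣t_ × Distributes Y _⊢t_ × Distributes Y _+t_
W-distrib {Y} grove with IsGrove.nonempty grove
... | leaf , leaf∈Y =
  L.distributes _⊣t_ ⊣t-nonempty (λ _ → (λ z∈ → z∈) , (λ z∈ → z∈)) ,
  L.distributes _⊢t_ ⊢t-nonempty (λ _ → (λ z∈ → z∈) , (λ z∈ → z∈)) ,
  L.distributes _+t_ +t-nonempty (λ _ → (λ z∈ → Shuffle-leafˡ-unique (+t⇒Shuffle {leaf} {leaf} z∈)) , λ { refl → ≤-refl , ≤-refl })
  where
  module L = LeafGrove Y (λ y∈ → 0≡deg⇒leaf (IsGrove.homogeneous grove leaf∈Y y∈)) leaf∈Y
... | node _ _ , y₀∈Y = N.distrib-⊣ , N.distrib-⊢ , N.distrib-+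
  where
  module N = NodeGrove Y (λ y∈ → suc≡deg⇒node (IsGrove.homogeneous grove y₀∈Y y∈)) y₀∈Y

one : Tree
one = leaf ∨ leaf

singleton-IsGrove : ∀ t → IsGrove ⟦ t ⟧
singleton-IsGrove t = record { nonempty = t , refl ; homogeneous = λ { refl refl → refl } }

one-IsNode : ∀ {t} → ⟦ one ⟧ t → IsNode t
one-IsNode refl = leaf , leaf , refl

private
  module OneGrove = NodeGrove ⟦ one ⟧ one-IsNode refl

W-one : ∀ t {z} → W t ⟦ one ⟧ z → z ≡ t
W-one leaf       z∈ = z∈
W-one (node l r) z∈ with OneGrove.W⇒W∨ l r z∈
... | w∨ p∈ refl q∈ sw sm with W-one l p∈ | W-one r q∈ | Shuffle-leafʳ-unique sw | Shuffle-leafˡ-unique sm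
... | refl | refl | refl | refl = refl

-- With y = y′ = 1 the right-hand side is x ∙ x, since x × 1 = x.
¬distribˡ-witness : ∀ _∙_ x z → (⟦ x ⟧ ×G lift _∙_ ⟦ one ⟧ ⟦ one ⟧) z → ¬ (x ∙ x) z →
  ∃[ X ] ∃[ y ] ∃[ y′ ] (IsGrove X × IsGrove y × IsGrove y′ × ¬ (X ×G lift _∙_ y y′ ≐ lift _∙_ (X ×G y) (X ×G y′)))
¬distribˡ-witness _∙_ x z z∈ z∉ =
  ⟦ x ⟧ , ⟦ one ⟧ , ⟦ one ⟧ , singleton-IsGrove x , singleton-IsGrove one , singleton-IsGrove one ,
  λ eq → excluded (proj₁ (eq z) z∈)
  where
  excluded : ¬ lift _∙_ (⟦ x ⟧ ×G ⟦ one ⟧) (⟦ x ⟧ ×G ⟦ one ⟧) z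
  excluded (_ , _ , (_ , refl , p∈) , (_ , refl , q∈) , z∈pq) with W-one x p∈ | W-one x q∈
  ... | refl | refl = z∉ z∈pq

∈W-one : ∀ {Y y₁ y₂} → Y (y₁ ∨ y₂) → W one Y (y₁ ∨ y₂)
∈W-one {y₁ = y₁} {y₂} y∈ = W∨⇒W leaf leaf (w∨ refl y∈ refl (Shuffle-leafˡ y₁) (Shuffle-leafʳ y₂))

×G-¬distribˡ-⊣ : ∃[ x ] ∃[ y ] ∃[ y′ ] (IsGrove x × IsGrove y × IsGrove y′ × ¬ (x ×G (y ⊣G y′) ≐ (x ×G y) ⊣G (x ×G y′)))
×G-¬distribˡ-⊣ = ¬distribˡ-witness _⊣t_ (one ∨ leaf) ((leaf ∨ one) ∨ one)
  (_ , refl , W∨⇒W one leaf (w∨ (∈W-one r∈) r∈ refl (Shuffle-leafʳ _) (Shuffle-leafʳ one)))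
  λ { (_ , _ , ()) }
  where
  r∈ : (⟦ one ⟧ ⊣G ⟦ one ⟧) (leaf ∨ one)
  r∈ = one , one , refl , refl , one , Shuffle⇒+t (Shuffle-leafˡ one) , refl

×G-¬distribˡ-⊢ : ∃[ x ] ∃[ y ] ∃[ y′ ] (IsGrove x × IsGrove y × IsGrove y′ × ¬ (x ×G (y ⊢G y′) ≐ (x ×G y) ⊢G (x ×G y′)))
×G-¬distribˡ-⊢ = ¬distribˡ-witness _⊢t_ (leaf ∨ one) (one ∨ (one ∨ leaf))
  (_ , refl , W∨⇒W leaf one (w∨ refl l∈ (∈W-one l∈) (Shuffle-leafˡ one) (Shuffle-leafˡ _)))
  λ { (_ , _ , ()) }
  where
  l∈ : (⟦ one ⟧ ⊢G ⟦ one ⟧) (one ∨ leaf)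
  l∈ = one , one , refl , refl , one , Shuffle⇒+t (Shuffle-leafʳ one) , refl

×G-¬distribˡ-+ : ∃[ x ] ∃[ y ] ∃[ y′ ] (IsGrove x × IsGrove y × IsGrove y′ × ¬ (x ×G (y +G y′) ≐ (x ×G y) +G (x ×G y′)))
×G-¬distribˡ-+ = ¬distribˡ-witness _+t_ (leaf ∨ one) (one ∨ (leaf ∨ one))
  (_ , refl , W∨⇒W leaf one (w∨ refl l∈ (∈W-one r∈) (Shuffle-leafˡ one) (Shuffle-leafˡ _)))
  λ z∈ → not-shuffle (+t⇒Shuffle {leaf ∨ one} {leaf ∨ one} z∈)
  where
  l∈ : (⟦ one ⟧ +G ⟦ one ⟧) (one ∨ leaf)
  l∈ = one , one , refl , refl , Shuffle⇒+t (takeʳ (Shuffle-leafʳ one))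
  r∈ : (⟦ one ⟧ +G ⟦ one ⟧) (leaf ∨ one)
  r∈ = one , one , refl , refl , Shuffle⇒+t (takeˡ (Shuffle-leafˡ one))
  not-shuffle : ¬ Shuffle (leaf ∨ one) (leaf ∨ one) (one ∨ (leaf ∨ one))
  not-shuffle ()

×G-distribʳ : (x x′ y : Grove) → IsGrove y →
    ((x ⊣G x′) ×G y ≐ (x ×G y) ⊣G (x′ ×G y))
  × ((x ⊢G x′) ×G y ≐ (x ×G y) ⊢G (x′ ×G y))
  × ((x +G x′) ×G y ≐ (x ×G y) +G (x′ ×G y))
×G-distribʳ x x′ y grove with W-distrib grove
... | ⊣-dist , ⊢-dist , +-dist =
  ×G-distribʳ-lift y _⊣t_ ⊣-dist x x′ , ×G-distribʳ-lift y _⊢t_ ⊢-dist x x′ , ×G-distribʳ-lift y _+t_ +-dist x x′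

proposition6p2 :
    ((x x′ y : Grove) → IsGrove x → IsGrove x′ → IsGrove y →
        ((x ⊣G x′) ×G y ≐ (x ×G y) ⊣G (x′ ×G y))
      × ((x ⊢G x′) ×G y ≐ (x ×G y) ⊢G (x′ ×G y))
      × ((x +G x′) ×G y ≐ (x ×G y) +G (x′ ×G y)))
    × (∃[ x ] ∃[ y ] ∃[ y′ ] (IsGrove x × IsGrove y × IsGrove y′ ×
          ¬ (x ×G (y ⊣G y′) ≐ (x ×G y) ⊣G (x ×G y′))))
    × (∃[ x ] ∃[ y ] ∃[ y′ ] (IsGrove x × IsGrove y × IsGrove y′ ×
          ¬ (x ×G (y ⊢G y′) ≐ (x ×G y) ⊢G (x ×G y′))))
    × (∃[ x ] ∃[ y ] ∃[ y′ ] (IsGrove x × IsGrove y × IsGrove y′ ×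
          ¬ (x ×G (y +G y′) ≐ (x ×G y) +G (x ×G y′))))
proposition6p2 =
  (λ x x′ y _ _ grove → ×G-distribʳ x x′ y grove) , ×G-¬distribˡ-⊣ , ×G-¬distribˡ-⊢ , ×G-¬distribˡ-+
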